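{- Let $F$ be an unsatisfiable clause-set. Consider the following game between Prover and Delayer on a partial assignment $\theta$ with $\mathrm{var}(\theta)\subseteq\mathrm{var}(F)$ at all times. Initially $\theta$ is empty; the players move alternately, Delayer first. Delayer replaces $\theta$ by any $\theta'\supseteq\theta$. Prover replaces $\theta$ by some partial assignment $\theta'$ compatible with $\theta$ (i.e. agreeing with $\theta$ on $\mathrm{var}(\theta)\cap\mathrm{var}(\theta')$) with $|\mathrm{var}(\theta')\setminus\mathrm{var}(\theta)|=1$ (so Prover may drop assigned variables). As soon as $\bot\in\theta*F$ the game ends, and Delayer receives as points the maximum of $n(\theta')$ over all assignments $\theta'$ chosen by Prover during the game ($0$ if Prover made no move). Prover must play so that the game is finite. Then: (1) if Delayer has a strategy achieving at least $k\in\mathbb{N}$ points against every Prover play, then $\mathrm{whd}(F)\ge k$; (2) if Prover has a strategy guaranteeing that Delayer gets at most $k\in\mathbb{N}_0$ points, then $\mathrm{whd}(F)\le k$; (3) Delayer has a strategy guaranteeing at least $\mathrm{whd}(F)$ points against every Prover play; (4) Prover has a strategy guaranteeing that Delayer gets at most $\mathrm{whd}(F)$ points against every Delayer play.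
   Context: Literals are variables $v$ or negations $\overline{v}$; clauses are finite sets of literals without complementary pair; clause-sets are finite sets of clauses; $\bot$ is the empty clause; $\mathrm{var}(F)$ the set of variables of $F$. A partial assignment $\varphi$ maps a finite variable set $\mathrm{var}(\varphi)$ to $\{0,1\}$, $n(\varphi)=|\mathrm{var}(\varphi)|$; $\varphi*F$ removes satisfied clauses and false literals. $F$ is unsatisfiable if no $\varphi$ satisfies all clauses. Resolution: clauses $C,D$ with exactly one clashing literal $x\in C,\overline{x}\in D$ have resolvent $(C\cup D)\setminus\{x,\overline{x}\}$. A resolution tree is a finite rooted tree, inner nodes having exactly two children, nodes labelled by clauses, each inner label the resolvent of its children's labels; a refutation of $F$ has leaves labelled by clauses of $F$ and root labelled $\bot$. Asymmetric width: $\mathrm{whd}(T)=0$ for a single node; otherwise, with root children labelled $C_1,C_2$ and subtrees $T_1,T_2$, $\mathrm{whd}(T)=\max(\mathrm{whd}(T_1),\mathrm{whd}(T_2),\min(|C_1|,|C_2|))$. $\mathrm{whd}(F)$ is the minimum of $\mathrm{whd}(T)$ over refutations $T$ of $F$. -}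

module Defs where

open import Data.Nat using (ℕ; zero; suc; _≤_; _⊔_; _⊓_)
open import Data.Bool using (Bool; true; false; not)
open import Data.Maybe using (Maybe; just; nothing; _>>=_)
open import Data.Fin using (Fin)
open import Data.Vec using (Vec; []; _∷_; lookup; replicate)
open import Data.List using (List; mapMaybe)
import Data.List as List
open import Data.List.Membership.Propositional using (_∈_)
open import Data.Product using (Σ; ∃; ∃-syntax; Σ-syntax; _×_)
open import Data.Sum using (_⊎_)
open import Relation.Nullary using (¬_)
open import Relation.Binary.PropositionalEquality using (_≡_; _≢_)

-- A clause over Fin n is a vector recording, for each variable v,
--   nothing  : neither v nor its negation occurs,
--   just true  : the positive literal v occurs,
--   just false : the negative literal (v-bar) occurs.
-- This represents exactly the finite sets of literals without a
-- complementary pair.  A partial assignment uses the same shape: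
-- nothing = unassigned, just b = assigned the value b.

Clause : ℕ → Set
Clause n = Vec (Maybe Bool) n

ClauseSet : ℕ → Set
ClauseSet n = List (Clause n)   -- finite set of clauses (list up to membership)

Assign : ℕ → Set
Assign n = Vec (Maybe Bool) n

emptyClause : ∀ {n} → Clause n
emptyClause {n} = replicate n nothing

-- number of literals of a clause / number of assigned variables n(φ)
size : ∀ {n} → Vec (Maybe Bool) n → ℕ
size [] = 0
size (just _ ∷ v) = suc (size v)
size (nothing ∷ v) = size v

VarF : ∀ {n} → ClauseSet n → Fin n → Set
VarF F v = ∃[ C ] (C ∈ F × ∃[ b ] lookup C v ≡ just b)

VarsIn : ∀ {n} → ClauseSet n → Assign n → Set
VarsIn F θ = ∀ v b → lookup θ v ≡ just b → VarF F v

SatisfiesClause : ∀ {n} → Assign n → Clause n → Set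
SatisfiesClause φ C = ∃[ v ] ∃[ b ] (lookup C v ≡ just b × lookup φ v ≡ just b)

Unsatisfiable : ∀ {n} → ClauseSet n → Set
Unsatisfiable F = ∀ φ → ¬ (∀ C → C ∈ F → SatisfiesClause φ C)

-- per variable: nothing = clause satisfied here; just l = residual entry
applyLit : Maybe Bool → Maybe Bool → Maybe (Maybe Bool)
applyLit nothing l = just l
applyLit (just _) nothing = just nothing
applyLit (just true) (just true) = nothing
applyLit (just false) (just false) = nothing
applyLit (just true) (just false) = just nothing
applyLit (just false) (just true) = just nothing

-- φ * C : nothing if φ satisfies C, otherwise C with the false literals removed
applyClause : ∀ {n} → Assign n → Clause n → Maybe (Clause n)
applyClause [] [] = just []
applyClause (a ∷ φ) (l ∷ C) =
  applyLit a l >>= λ l′ → applyClause φ C >>= λ C′ → just (l′ ∷ C′)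

_*_ : ∀ {n} → Assign n → ClauseSet n → ClauseSet n
φ * F = mapMaybe (applyClause φ) F

Ends : ∀ {n} → ClauseSet n → Assign n → Set
Ends F θ = emptyClause ∈ (θ * F)

Clash : ∀ {n} → Clause n → Clause n → Fin n → Set
Clash C D w = ∃[ b ] (lookup C w ≡ just b × lookup D w ≡ just (not b))

-- union of the entries of two clauses at a non-clashing variable
unionLit : Maybe Bool → Maybe Bool → Maybe Bool
unionLit nothing y = y
unionLit (just b) _ = just b

Resolvent : ∀ {n} → Clause n → Clause n → Clause n → Set
Resolvent C D R = ∃[ v ]
  ( Clash C D v
  × (∀ w → w ≢ v → ¬ Clash C D w)
  × lookup R v ≡ nothing
  × (∀ w → w ≢ v → lookup R w ≡ unionLit (lookup C w) (lookup D w)))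

data RTree (n : ℕ) : Set where
  leaf : Clause n → RTree n
  node : Clause n → RTree n → RTree n → RTree n

label : ∀ {n} → RTree n → Clause n
label (leaf C) = C
label (node C _ _) = C

data ValidTree {n} (F : ClauseSet n) : RTree n → Set where
  leafV : ∀ {C} → C ∈ F → ValidTree F (leaf C)
  nodeV : ∀ {C T₁ T₂} → Resolvent (label T₁) (label T₂) C →
          ValidTree F T₁ → ValidTree F T₂ → ValidTree F (node C T₁ T₂)

Refutation : ∀ {n} → ClauseSet n → RTree n → Set
Refutation F T = ValidTree F T × label T ≡ emptyClause

whdT : ∀ {n} → RTree n → ℕ
whdT (leaf _) = 0
whdT (node _ T₁ T₂) = whdT T₁ ⊔ whdT T₂ ⊔ (size (label T₁) ⊓ size (label T₂))

IsWhd : ∀ {n} → ClauseSet n → ℕ → Set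
IsWhd F w = (∃[ T ] (Refutation F T × whdT T ≡ w))
          × (∀ T → Refutation F T → w ≤ whdT T)

ε : ∀ {n} → Assign n
ε {n} = replicate n nothing

DMove : ∀ {n} → ClauseSet n → Assign n → Assign n → Set
DMove F θ θ′ = (∀ v b → lookup θ v ≡ just b → lookup θ′ v ≡ just b) × VarsIn F θ′

PMove : ∀ {n} → ClauseSet n → Assign n → Assign n → Set
PMove F θ θ′ =
    (∀ v b b′ → lookup θ v ≡ just b → lookup θ′ v ≡ just b′ → b ≡ b′)
  × (∃[ v ] ( lookup θ v ≡ nothing
            × (∃[ b ] lookup θ′ v ≡ just b)
            × (∀ w → lookup θ w ≡ nothing → (∃[ b ] lookup θ′ w ≡ just b) → w ≡ v)))
  × VarsIn F θ′

-- Prover strategies are represented as well-founded strategy trees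
-- (so every play consistent with them is finite).  k is the bound on
-- Delayer's points, m the maximum of n(θ′) over Prover's moves so far.
mutual
  data PWinD {n} (F : ClauseSet n) (k : ℕ) (θ : Assign n) (m : ℕ) : Set where
    pwinD : (∀ θ′ → DMove F θ θ′ →
               (Ends F θ′ → m ≤ k) × (¬ Ends F θ′ → PWinP F k θ′ m)) →
            PWinD F k θ m

  data PWinP {n} (F : ClauseSet n) (k : ℕ) (θ : Assign n) (m : ℕ) : Set where
    pwinP : (θ′ : Assign n) → PMove F θ θ′ →
            ((Ends F θ′ × (m ⊔ size θ′) ≤ k) ⊎
             (¬ Ends F θ′ × PWinD F k θ′ (m ⊔ size θ′))) →
            PWinP F k θ m

ProverGuarantees : ∀ {n} → ClauseSet n → ℕ → Set
ProverGuarantees F k = ¬ Ends F ε → PWinD F k ε 0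

-- Delayer strategies: given the current state θ and the list of earlier
-- states (most recent first), choose the next assignment.
DStrategy : ℕ → Set
DStrategy n = Assign n → List (Assign n) → Assign n

-- DPlay F δ θ h m : a finite play consistent with δ reaches state θ with
-- Delayer to move, the game not ended, earlier states h, and Prover's
-- maximum n(θ′) so far equal to m.
data DPlay {n} (F : ClauseSet n) (δ : DStrategy n) :
     Assign n → List (Assign n) → ℕ → Set where
  start : ¬ Ends F ε → DPlay F δ ε List.[] 0
  step  : ∀ {θ h m θ′} → DPlay F δ θ h m →
          ¬ Ends F (δ θ h) → PMove F (δ θ h) θ′ → ¬ Ends F θ′ →
          DPlay F δ θ′ (δ θ h List.∷ θ List.∷ h) (m ⊔ size θ′)

DelayerAchieves : ∀ {n} → ClauseSet n → ℕ → Set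
DelayerAchieves {n} F k = Σ[ δ ∈ DStrategy n ]
    ((Ends F ε → k ≤ 0)
  × (∀ θ h m → DPlay F δ θ h m → DMove F θ (δ θ h))
  × (∀ θ h m → DPlay F δ θ h m → Ends F (δ θ h) → k ≤ m)
  × (∀ θ h m θ′ → DPlay F δ θ h m → ¬ Ends F (δ θ h) →
        PMove F (δ θ h) θ′ → Ends F θ′ → k ≤ m ⊔ size θ′))

-- Parts (1) and (2) follow from (3) and (4), since a Delayer strategy securing a points played
-- against a Prover strategy conceding at most b points forces a ≤ b.
--
-- (4): Prover walks down a refutation T with whd(T) = whd(F), keeping the current assignment
-- falsifying the label of the current node.  At a resolution on v, if v is assigned then one
-- premise is already falsified and Prover descends without moving; otherwise Prover keeps only
-- the negation of the smaller premise, which assigns v and has min(|C₁|,|C₂|) ≤ whd(T) variables.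
-- Reaching a leaf means a clause of F is falsified, so the game is over.
--
-- (3): if whd(F) = j + 1, the clauses derivable by trees of asymmetric width ≤ j form a set D
-- (computed as a fixpoint over the finitely many clauses) that contains F, is closed under
-- resolutions with a premise of size ≤ j, and does not contain ⊥.  Delayer never falsifies a
-- clause of D and saturates his assignment: whenever setting a free x to b would falsify a clause
-- of D of size ≤ j, he sets x to ¬ b.  This is safe, as otherwise the two falsified clauses would
-- resolve on x to a clause of D that is already falsified.  A Prover assignment of size ≤ j that
-- falsified a clause of D would exhibit such a forced variable, so the game can only end after
-- Prover has chosen an assignment of size > j.

module Submission where

open import Defs
open import Data.Bool using (Bool; true; false; not; T; _∨_; if_then_else_)
import Data.Bool.Properties as Boolₚ
open import Data.Bool.Properties using (not-involutive)
open import Data.Fin using (Fin; zero; suc)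
import Data.Fin.Properties as Finₚ
open import Data.Empty using (⊥-elim)
open import Data.Sum using (_⊎_; inj₁; inj₂; [_,_]′)
open import Data.List using (List; []; _∷_; length; cartesianProductWith; mapMaybe)
open import Data.List.Membership.Propositional using (_∈_; lose)
open import Data.List.Membership.Propositional.Properties using (∈-cartesianProductWith⁺)
open import Data.List.Relation.Unary.Any using (Any; here; there; any?; satisfied)
open import Data.Nat using (ℕ; zero; suc; _+_; _≤_; _<_; _⊔_; _⊓_; z≤n; s≤s; _≤?_)
open import Data.Nat.Properties
  using (≤-refl; ≤-trans; ≤-pred; n≤1+n; m≤n⇒m≤1+n; m≤n+m; <⇒≱; ≰⇒>; +-identityʳ; +-suc; +-monoˡ-≤;
         m⊔n≤o⇒m≤o; m⊔n≤o⇒n≤o; ⊔-lub; ⊓-sel; m⊓n≤m)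
open import Data.Product using (Σ-syntax; ∃; _×_; _,_; proj₁; proj₂; map₁; map₂)
open import Data.Vec using (Vec; []; _∷_; lookup; _[_]≔_; zipWith)
import Data.Vec as Vec
import Data.Vec.Properties as Vecₚ
open import Data.Maybe using (Maybe; just; nothing)
import Data.Maybe as Maybe
import Data.Maybe.Properties as Maybeₚ
open import Function using (_∘_; id)
open import Function.Bundles using (Equivalence)
open import Relation.Nullary using (¬_; Dec; yes; no; isYes; contradiction)
open import Relation.Nullary.Decidable using (_×-dec_; _→-dec_; ¬?; T?; map′; decidable-stable; toWitness; fromWitness)
open import Relation.Unary using (_⊆_)
open import Relation.Binary.Definitions using (DecidableEquality)
open import Relation.Binary.PropositionalEquality using (_≡_; _≢_; refl; sym; trans; cong; subst)

_≟ₗ_ : DecidableEquality (Maybe Bool)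
_≟ₗ_ = Maybeₚ.≡-dec Boolₚ._≟_

_≟ᶜ_ : ∀ {n} → DecidableEquality (Clause n)
_≟ᶜ_ = Vecₚ.≡-dec _≟ₗ_

FalsifiesLit : Maybe Bool → Maybe Bool → Set
FalsifiesLit a l = ∀ b → l ≡ just b → a ≡ just (not b)

Falsifies : ∀ {n} → Assign n → Clause n → Set
Falsifies θ C = ∀ v → FalsifiesLit (lookup θ v) (lookup C v)

FalsifiesExcept : ∀ {n} → Fin n → Assign n → Clause n → Set
FalsifiesExcept x θ C = ∀ v → v ≢ x → FalsifiesLit (lookup θ v) (lookup C v)

_⊑_ : ∀ {n} → Assign n → Assign n → Set
θ ⊑ θ′ = ∀ v b → lookup θ v ≡ just b → lookup θ′ v ≡ just b

falsifiesLit-just : ∀ {a l c} → l ≡ just c → a ≡ just (not c) → FalsifiesLit a l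
falsifiesLit-just refl e _ refl = e

falsifiesLit? : ∀ a l → Dec (FalsifiesLit a l)
falsifiesLit? a nothing = yes λ _ ()
falsifiesLit? a (just c) = map′ (λ { eq b refl → eq }) (λ f → f c refl) (a ≟ₗ just (not c))

falsifies? : ∀ {n} (θ : Assign n) C → Dec (Falsifies θ C)
falsifies? θ C = Finₚ.all? λ v → falsifiesLit? (lookup θ v) (lookup C v)

falsifies-⊑ : ∀ {n} {θ θ′ : Assign n} {C} → θ ⊑ θ′ → Falsifies θ C → Falsifies θ′ C
falsifies-⊑ ext f v b e = ext v (not b) (f v b e)

⊑-update : ∀ {n} (θ : Assign n) x a → lookup θ x ≡ nothing → θ ⊑ (θ [ x ]≔ a)
⊑-update θ x a free v b e with v Finₚ.≟ x
... | yes refl with () ← trans (sym free) e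
... | no v≢x = trans (Vecₚ.lookup∘update′ v≢x θ a) e

size-cons : ∀ {n} a (θ : Assign n) → size θ ≤ size (a ∷ θ)
size-cons nothing θ = ≤-refl
size-cons (just _) θ = n≤1+n (size θ)

⊑⇒size≤ : ∀ {n} {θ θ′ : Assign n} → θ ⊑ θ′ → size θ ≤ size θ′
⊑⇒size≤ {θ = []} {[]} _ = z≤n
⊑⇒size≤ {θ = nothing ∷ θ} {a ∷ θ′} ext =
  ≤-trans (⊑⇒size≤ {θ = θ} {θ′} (ext ∘ suc)) (size-cons a θ′)
⊑⇒size≤ {θ = just b ∷ θ} {a ∷ θ′} ext with ext zero b refl
... | refl = s≤s (⊑⇒size≤ {θ = θ} {θ′} (ext ∘ suc))

falsifier : ∀ {n} → Clause n → Assign n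
falsifier = Vec.map (Maybe.map not)

size-falsifier : ∀ {n} (C : Clause n) → size (falsifier C) ≡ size C
size-falsifier [] = refl
size-falsifier (nothing ∷ C) = size-falsifier C
size-falsifier (just _ ∷ C) = cong suc (size-falsifier C)

lookup-falsifier : ∀ {n} (C : Clause n) v → lookup (falsifier C) v ≡ Maybe.map not (lookup C v)
lookup-falsifier C v = Vecₚ.lookup-map v (Maybe.map not) C

falsifier-falsifies : ∀ {n} (C : Clause n) → Falsifies (falsifier C) C
falsifier-falsifies C v b e rewrite lookup-falsifier C v | e = refl

falsifier-⊑ : ∀ {n} {θ : Assign n} {C} → Falsifies θ C → falsifier C ⊑ θ
falsifier-⊑ {C = C} f v b e rewrite lookup-falsifier C v with lookup C v in eC
... | just c with refl ← e = f v c eC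

falsifier-occurs : ∀ {n} (C : Clause n) {v b} → lookup (falsifier C) v ≡ just b → lookup C v ≡ just (not b)
falsifier-occurs C {v} e rewrite lookup-falsifier C v with lookup C v
... | just c with refl ← e = cong just (sym (not-involutive c))

falsifies⇒size≤ : ∀ {n} {θ : Assign n} {C} → Falsifies θ C → size C ≤ size θ
falsifies⇒size≤ {θ = θ} {C} f =
  subst (_≤ size θ) (size-falsifier C) (⊑⇒size≤ {θ = falsifier C} {θ} (falsifier-⊑ {θ = θ} {C} f))

module _ {n} {θ : Assign n} {x : Fin n} {C : Clause n} where

  falsifies-update⇒except : ∀ {a} → Falsifies (θ [ x ]≔ a) C → FalsifiesExcept x θ C
  falsifies-update⇒except {a} f v v≢x b e = trans (sym (Vecₚ.lookup∘update′ v≢x θ a)) (f v b e)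

  except⇒falsifies : FalsifiesExcept x θ C → FalsifiesLit (lookup θ x) (lookup C x) → Falsifies θ C
  except⇒falsifies off at v with v Finₚ.≟ x
  ... | yes refl = at
  ... | no v≢x = off v v≢x

  except⇒falsifies-update : ∀ {c} → FalsifiesExcept x θ C → lookup C x ≡ just c →
                             Falsifies (θ [ x ]≔ just (not c)) C
  except⇒falsifies-update {c} off Cx v with v Finₚ.≟ x
  ... | yes refl = falsifiesLit-just Cx (Vecₚ.lookup∘update x θ _)
  ... | no v≢x = λ b e → trans (Vecₚ.lookup∘update′ v≢x θ _) (off v v≢x b e)

  falsifies-update : ∀ {b} → Falsifies (θ [ x ]≔ just b) C → Falsifies θ C ⊎ lookup C x ≡ just (not b)
  falsifies-update {b} f with lookup C x in Cx
  ... | nothing = inj₁ (except⇒falsifies (falsifies-update⇒except f) λ _ e → contradiction (trans (sym Cx) e) λ ())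
  ... | just c = inj₂ (cong just (sym (trans (cong not b≡¬c) (not-involutive c))))
    where
    b≡¬c : b ≡ not c
    b≡¬c = Maybeₚ.just-injective (trans (sym (Vecₚ.lookup∘update x θ (just b))) (f x c Cx))

lookup-replicate-nothing : ∀ {n} (v : Fin n) {b : Bool} → lookup (Vec.replicate n nothing) v ≢ just b
lookup-replicate-nothing v e = contradiction (trans (sym (Vecₚ.lookup-replicate v nothing)) e) λ ()

falsifies-empty : ∀ {n} (θ : Assign n) → Falsifies θ emptyClause
falsifies-empty θ v b e = contradiction e (lookup-replicate-nothing v)

ε-falsifies⇒emptyClause : ∀ {n} (C : Clause n) → Falsifies ε C → C ≡ emptyClause
ε-falsifies⇒emptyClause [] _ = refl
ε-falsifies⇒emptyClause (nothing ∷ C) f = cong (nothing ∷_) (ε-falsifies⇒emptyClause C (f ∘ suc))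
ε-falsifies⇒emptyClause (just b ∷ C) f with () ← f zero b refl

⊑-trans : ∀ {n} {θ₁ θ₂ θ₃ : Assign n} → θ₁ ⊑ θ₂ → θ₂ ⊑ θ₃ → θ₁ ⊑ θ₃
⊑-trans ext₁ ext₂ v b = ext₂ v b ∘ ext₁ v b

unassigned : ∀ {n} → Assign n → ℕ
unassigned [] = 0
unassigned (nothing ∷ θ) = suc (unassigned θ)
unassigned (just _ ∷ θ) = unassigned θ

unassigned-update : ∀ {n} (θ : Assign n) x c → lookup θ x ≡ nothing →
                    unassigned θ ≡ suc (unassigned (θ [ x ]≔ just c))
unassigned-update (nothing ∷ θ) zero c _ = refl
unassigned-update (nothing ∷ θ) (suc x) c θx = cong suc (unassigned-update θ x c θx)
unassigned-update (just _ ∷ θ) (suc x) c θx = unassigned-update θ x c θx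

unionLit-falsified : ∀ {a l₁ l₂} → FalsifiesLit a l₁ → FalsifiesLit a l₂ →
                     FalsifiesLit a (unionLit l₁ l₂)
unionLit-falsified {l₁ = nothing} _ f₂ = f₂
unionLit-falsified {l₁ = just _} f₁ _ = f₁

unionLit-agrees : ∀ l {d} → (∀ b → l ≡ just b → d ≢ not b) → unionLit l (just d) ≡ just d
unionLit-agrees nothing _ = refl
unionLit-agrees (just b) {d} compatible =
  cong just (sym (trans (Boolₚ.¬-not (compatible b refl)) (not-involutive b)))

unionLit-occurs : ∀ l₁ l₂ {b} → unionLit l₁ l₂ ≡ just b → (∃ λ b′ → l₁ ≡ just b′) ⊎ l₂ ≡ just b
unionLit-occurs nothing _ e = inj₂ e
unionLit-occurs (just b′) _ _ = inj₁ (b′ , refl)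

resolvent-falsified⇒premises :
  ∀ {n} {θ : Assign n} {C₁ C₂ R v} →
  (∀ w → w ≢ v → ¬ Clash C₁ C₂ w) →
  (∀ w → w ≢ v → lookup R w ≡ unionLit (lookup C₁ w) (lookup C₂ w)) →
  Falsifies θ R → FalsifiesExcept v θ C₁ × FalsifiesExcept v θ C₂
resolvent-falsified⇒premises {C₁ = C₁} {C₂} no-clash R-union f =
    (λ w w≢v b e → f w b (trans (R-union w w≢v) (cong (λ l → unionLit l (lookup C₂ w)) e)))
  , (λ w w≢v d e → f w d (trans (R-union w w≢v) (trans (cong (unionLit (lookup C₁ w)) e)
       (unionLit-agrees (lookup C₁ w) λ b e₁ d≡¬b → no-clash w w≢v (b , e₁ , trans e (cong just d≡¬b))))))

falsifies-premise-at-pivot : ∀ {n} {θ : Assign n} {v C₁ C₂ c b} →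
  FalsifiesExcept v θ C₁ → FalsifiesExcept v θ C₂ → lookup C₁ v ≡ just c → lookup C₂ v ≡ just (not c) →
  lookup θ v ≡ just b → Falsifies θ C₁ ⊎ Falsifies θ C₂
falsifies-premise-at-pivot {θ = θ} {v} {C₁} {C₂} {c} {b} f₁ f₂ C₁v C₂v θv with b Boolₚ.≟ not c
... | yes refl = inj₁ (except⇒falsifies {θ = θ} {v} {C₁} f₁ (falsifiesLit-just C₁v θv))
... | no b≢¬c = inj₂ (except⇒falsifies {θ = θ} {v} {C₂} f₂
                       (falsifiesLit-just C₂v (trans θv (cong just (Boolₚ.¬-not b≢¬c)))))

resolveOn : ∀ {n} → Fin n → Clause n → Clause n → Clause n
resolveOn x C₁ C₂ = zipWith unionLit C₁ C₂ [ x ]≔ nothing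

resolveOn-union : ∀ {n} (x : Fin n) C₁ C₂ w → w ≢ x →
                  lookup (resolveOn x C₁ C₂) w ≡ unionLit (lookup C₁ w) (lookup C₂ w)
resolveOn-union x C₁ C₂ w w≢x =
  trans (Vecₚ.lookup∘update′ w≢x (zipWith unionLit C₁ C₂) nothing) (Vecₚ.lookup-zipWith unionLit w C₁ C₂)

module _ {n} {θ : Assign n} {x : Fin n} {C₁ C₂ : Clause n}
         (f₁ : FalsifiesExcept x θ C₁) (f₂ : FalsifiesExcept x θ C₂) where

  resolveOn-resolvent : ∀ {c} → lookup C₁ x ≡ just c → lookup C₂ x ≡ just (not c) →
                        Resolvent C₁ C₂ (resolveOn x C₁ C₂)
  resolveOn-resolvent {c} e₁ e₂ =
      x , (c , e₁ , e₂) , no-clash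
    , Vecₚ.lookup∘update x (zipWith unionLit C₁ C₂) nothing , resolveOn-union x C₁ C₂
    where
    no-clash : ∀ w → w ≢ x → ¬ Clash C₁ C₂ w
    no-clash w w≢x (d , d₁ , d₂) =
      Boolₚ.not-¬ refl (Maybeₚ.just-injective (trans (sym (f₁ w w≢x d d₁)) (f₂ w w≢x (not d) d₂)))

  resolveOn-falsified : Falsifies θ (resolveOn x C₁ C₂)
  resolveOn-falsified = except⇒falsifies {θ = θ} {x} {resolveOn x C₁ C₂}
    (λ w w≢x → subst (FalsifiesLit (lookup θ w)) (sym (resolveOn-union x C₁ C₂ w w≢x))
                     (unionLit-falsified (f₁ w w≢x) (f₂ w w≢x)))
    (subst (FalsifiesLit (lookup θ x)) (sym (Vecₚ.lookup∘update x (zipWith unionLit C₁ C₂) nothing)) λ _ ())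

label-VarF : ∀ {n} {F : ClauseSet n} {T} → ValidTree F T → ∀ v b → lookup (label T) v ≡ just b → VarF F v
label-VarF (leafV {C} C∈F) v b e = C , C∈F , b , e
label-VarF (nodeV {T₁ = T₁} (u , _ , _ , Ru , R-union) V₁ V₂) v b e with v Finₚ.≟ u
... | yes refl with () ← trans (sym Ru) e
... | no v≢u with unionLit-occurs (lookup (label T₁) v) _ (trans (sym (R-union v v≢u)) e)
...   | inj₁ (b′ , e₁) = label-VarF V₁ v b′ e₁
...   | inj₂ e₂ = label-VarF V₂ v b e₂

applyLit-falsified : ∀ a l → FalsifiesLit a l → applyLit a l ≡ just nothing
applyLit-falsified nothing nothing _ = refl
applyLit-falsified (just _) nothing _ = refl
applyLit-falsified a (just true) f rewrite f true refl = refl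
applyLit-falsified a (just false) f rewrite f false refl = refl

applyLit-falsifies : ∀ a l → applyLit a l ≡ just nothing → FalsifiesLit a l
applyLit-falsifies _ nothing _ _ ()
applyLit-falsifies nothing (just _) ()
applyLit-falsifies (just true) (just true) ()
applyLit-falsifies (just false) (just false) ()
applyLit-falsifies (just true) (just false) _ _ refl = refl
applyLit-falsifies (just false) (just true) _ _ refl = refl

applyClause-falsified : ∀ {n} (θ : Assign n) C → Falsifies θ C → applyClause θ C ≡ just emptyClause
applyClause-falsified [] [] _ = refl
applyClause-falsified (a ∷ θ) (l ∷ C) f
  rewrite applyLit-falsified a l (f zero) | applyClause-falsified θ C (f ∘ suc) = refl

applyClause-falsifies : ∀ {n} (θ : Assign n) C → applyClause θ C ≡ just emptyClause → Falsifies θ C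
applyClause-falsifies [] [] _ ()
applyClause-falsifies (a ∷ θ) (l ∷ C) e with applyLit a l in eₗ | applyClause θ C in e-C
... | just nothing | just _ with refl ← e = λ { zero → applyLit-falsifies a l eₗ
                                              ; (suc v) → applyClause-falsifies θ C e-C v }
... | just (just _) | just _ with () ← e
... | just _ | nothing with () ← e
... | nothing | _ with () ← e

module _ {A B : Set} (f : A → Maybe B) where

  ∈-mapMaybe⁺ : ∀ {x y xs} → x ∈ xs → f x ≡ just y → y ∈ mapMaybe f xs
  ∈-mapMaybe⁺ {xs = _ ∷ _} (here refl) e rewrite e = here refl
  ∈-mapMaybe⁺ {xs = x ∷ _} (there x∈xs) e with f x
  ... | nothing = ∈-mapMaybe⁺ x∈xs e
  ... | just _ = there (∈-mapMaybe⁺ x∈xs e)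

  ∈-mapMaybe⁻ : ∀ {y} xs → y ∈ mapMaybe f xs → ∃ λ x → x ∈ xs × f x ≡ just y
  ∈-mapMaybe⁻ (x ∷ xs) y∈ with f x in e | y∈
  ... | just _ | here refl = x , here refl , e
  ... | just _ | there y∈′ = map₂ (map₁ there) (∈-mapMaybe⁻ xs y∈′)
  ... | nothing | y∈′ = map₂ (map₁ there) (∈-mapMaybe⁻ xs y∈′)

module _ {n} (F : ClauseSet n) where

  falsified⇒Ends : ∀ {θ C} → C ∈ F → Falsifies θ C → Ends F θ
  falsified⇒Ends {θ} {C} C∈F f = ∈-mapMaybe⁺ (applyClause θ) C∈F (applyClause-falsified θ C f)

  Ends⇒falsified : ∀ {θ} → Ends F θ → ∃ λ C → C ∈ F × Falsifies θ C
  Ends⇒falsified {θ} ends with ∈-mapMaybe⁻ (applyClause θ) F ends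
  ... | C , C∈F , e = C , C∈F , applyClause-falsifies θ C e

  ends? : ∀ θ → Dec (Ends F θ)
  ends? θ = emptyClause ∈? (θ * F)
    where open import Data.List.Membership.DecPropositional (_≟ᶜ_ {n}) using (_∈?_)

PMove-within-update : ∀ {n} {F : ClauseSet n} {θ θ′ : Assign n} {x b} → lookup θ x ≡ nothing →
                      θ′ ⊑ (θ [ x ]≔ just b) → lookup θ′ x ≡ just b → VarsIn F θ′ → PMove F θ θ′
PMove-within-update {θ = θ} {θ′} {x} {b} θx sub θ′x vars = compatible , (x , θx , (b , θ′x) , only-x) , vars
  where
  compatible : ∀ v b₁ b₂ → lookup θ v ≡ just b₁ → lookup θ′ v ≡ just b₂ → b₁ ≡ b₂
  compatible v b₁ b₂ e₁ e₂ =
    Maybeₚ.just-injective (trans (sym (⊑-update θ x (just b) θx v b₁ e₁)) (sub v b₂ e₂))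
  only-x : ∀ w → lookup θ w ≡ nothing → (∃ λ b′ → lookup θ′ w ≡ just b′) → w ≡ x
  only-x w θw (b′ , e) with w Finₚ.≟ x
  ... | yes w≡x = w≡x
  ... | no w≢x with () ← trans (sym θw) (trans (sym (Vecₚ.lookup∘update′ w≢x θ _)) (sub w b′ e))

PMove⇒⊑-update : ∀ {n} {F : ClauseSet n} {θ θ′ : Assign n} → PMove F θ θ′ →
                 ∃ λ x → lookup θ x ≡ nothing × ∃ λ b → θ′ ⊑ (θ [ x ]≔ just b)
PMove⇒⊑-update {θ = θ} {θ′} (compatible , (x , θx , (b , θ′x) , only-x) , _) = x , θx , b , sub
  where
  sub : θ′ ⊑ (θ [ x ]≔ just b)
  sub v b′ e with v Finₚ.≟ x
  ... | yes refl = trans (Vecₚ.lookup∘update x θ _) (trans (sym θ′x) e)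
  ... | no v≢x with lookup θ v in θv
  ...   | just b″ = trans (Vecₚ.lookup∘update′ v≢x θ _) (trans θv (cong just (compatible v b″ b′ θv e)))
  ...   | nothing = contradiction (only-x v θv (b′ , e)) v≢x

VarsIn-update : ∀ {n} {F : ClauseSet n} (θ : Assign n) x c → VarsIn F θ → VarF F x → VarsIn F (θ [ x ]≔ just c)
VarsIn-update θ x c vars var-x v b e with v Finₚ.≟ x
... | yes refl = var-x
... | no v≢x = vars v b (trans (sym (Vecₚ.lookup∘update′ v≢x θ _)) e)

-- The Prover strategy read off a refutation

⊓≤⇒≤⊎≤ : ∀ {m n k} → m ⊓ n ≤ k → m ≤ k ⊎ n ≤ k
⊓≤⇒≤⊎≤ {m} {n} {k} le with ⊓-sel m n
... | inj₁ m⊓n≡m = inj₁ (subst (_≤ k) m⊓n≡m le)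
... | inj₂ m⊓n≡n = inj₂ (subst (_≤ k) m⊓n≡n le)

whdT-node≤ : ∀ {n} {C : Clause n} T₁ T₂ {k} → whdT (node C T₁ T₂) ≤ k →
             whdT T₁ ≤ k × whdT T₂ ≤ k × (size (label T₁) ≤ k ⊎ size (label T₂) ≤ k)
whdT-node≤ T₁ T₂ {k} le =
    m⊔n≤o⇒m≤o (whdT T₁) _ subtrees≤ , m⊔n≤o⇒n≤o (whdT T₁) _ subtrees≤
  , ⊓≤⇒≤⊎≤ (m⊔n≤o⇒n≤o (whdT T₁ ⊔ whdT T₂) _ le)
  where
  subtrees≤ : whdT T₁ ⊔ whdT T₂ ≤ k
  subtrees≤ = m⊔n≤o⇒m≤o (whdT T₁ ⊔ whdT T₂) _ le

module TreeStrategy {n} (F : ClauseSet n) (k : ℕ) where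

  mutual
    delayer-turn : ∀ {T} → ValidTree F T → whdT T ≤ k → ∀ {θ} → Falsifies θ (label T) →
                   ∀ {m} → m ≤ k → PWinD F k θ m
    delayer-turn {T} V w≤k {θ} f m≤k = pwinD λ θ′ (θ⊑θ′ , _) →
      (λ _ → m≤k) , prover-turn V w≤k (falsifies-⊑ {θ = θ} {θ′} {label T} θ⊑θ′ f) m≤k

    prover-turn : ∀ {T} → ValidTree F T → whdT T ≤ k → ∀ {θ} → Falsifies θ (label T) →
                  ∀ {m} → m ≤ k → ¬ Ends F θ → PWinP F k θ m
    prover-turn (leafV {C} C∈F) _ {θ} f _ ¬ends = contradiction (falsified⇒Ends F {θ} {C} C∈F f) ¬ends
    prover-turn (nodeV {C} {T₁} {T₂} (v , (c , C₁v , C₂v) , no-clash , _ , R-union) V₁ V₂)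
                w≤k {θ} f {m} m≤k ¬ends =
      at-pivot (lookup θ v) refl (whdT-node≤ {C = C} T₁ T₂ w≤k)
      where
      premises : FalsifiesExcept v θ (label T₁) × FalsifiesExcept v θ (label T₂)
      premises = resolvent-falsified⇒premises {θ = θ} {label T₁} {label T₂} {C} no-clash R-union f
      at-pivot : ∀ a → lookup θ v ≡ a →
                 whdT T₁ ≤ k × whdT T₂ ≤ k × (size (label T₁) ≤ k ⊎ size (label T₂) ≤ k) → PWinP F k θ m
      at-pivot nothing θv (w₁ , _ , inj₁ size₁≤k) = query V₁ w₁ θv (proj₁ premises) C₁v size₁≤k m≤k
      at-pivot nothing θv (_ , w₂ , inj₂ size₂≤k) = query V₂ w₂ θv (proj₂ premises) C₂v size₂≤k m≤k
      at-pivot (just b) θv (w₁ , w₂ , _) =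
        [ (λ f₁ → prover-turn V₁ w₁ f₁ m≤k ¬ends) , (λ f₂ → prover-turn V₂ w₂ f₂ m≤k ¬ends) ]′
          (falsifies-premise-at-pivot {θ = θ} {v} {label T₁} {label T₂}
             (proj₁ premises) (proj₂ premises) C₁v C₂v θv)

    query : ∀ {T} → ValidTree F T → whdT T ≤ k → ∀ {θ v c} → lookup θ v ≡ nothing →
            FalsifiesExcept v θ (label T) → lookup (label T) v ≡ just c → size (label T) ≤ k →
            ∀ {m} → m ≤ k → PWinP F k θ m
    query {T} V w≤k {θ} {v} {c} θv off Tv size≤k {m} m≤k = pwinP θ′ move continue
      where
      θ′ : Assign n
      θ′ = falsifier (label T)
      move : PMove F θ θ′
      move = PMove-within-update {θ = θ} {θ′} θv
               (falsifier-⊑ {θ = θ [ v ]≔ just (not c)} {label T}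
                  (except⇒falsifies-update {θ = θ} {v} {label T} off Tv))
               (trans (lookup-falsifier (label T) v) (cong (Maybe.map not) Tv))
               (λ u b e → label-VarF V u (not b) (falsifier-occurs (label T) e))
      bound : m ⊔ size θ′ ≤ k
      bound = ⊔-lub m≤k (subst (_≤ k) (sym (size-falsifier (label T))) size≤k)
      continue : (Ends F θ′ × m ⊔ size θ′ ≤ k) ⊎ (¬ Ends F θ′ × PWinD F k θ′ (m ⊔ size θ′))
      continue with ends? F θ′
      ... | yes ends = inj₁ (ends , bound)
      ... | no ¬ends = inj₂ (¬ends , delayer-turn V w≤k (falsifier-falsifies (label T)) bound)

  refutation⇒ProverGuarantees : ∀ {T} → Refutation F T → whdT T ≤ k → ProverGuarantees F k
  refutation⇒ProverGuarantees (V , root) w≤k _ =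
    delayer-turn V w≤k (subst (Falsifies ε) (sym root) (falsifies-empty ε)) z≤n

prover-guarantees-whd : ∀ {n} (F : ClauseSet n) {w} → IsWhd F w → ProverGuarantees F w
prover-guarantees-whd F ((T , refutation , refl) , _) =
  TreeStrategy.refutation⇒ProverGuarantees F (whdT T) refutation ≤-refl

-- Playing a Delayer strategy against a Prover strategy

module Playoff {n} {F : ClauseSet n} {a b : ℕ} (δ : DStrategy n)
  (legal : ∀ θ h m → DPlay F δ θ h m → DMove F θ (δ θ h))
  (delayer-ends : ∀ θ h m → DPlay F δ θ h m → Ends F (δ θ h) → a ≤ m)
  (prover-ends : ∀ θ h m θ′ → DPlay F δ θ h m → ¬ Ends F (δ θ h) →
                 PMove F (δ θ h) θ′ → Ends F θ′ → a ≤ m ⊔ size θ′) where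

  play-against : ∀ {θ h m} → DPlay F δ θ h m → PWinD F b θ m → a ≤ b
  play-against {θ} {h} {m} play (pwinD respond) with ends? F (δ θ h)
  ... | yes ends = ≤-trans (delayer-ends θ h m play ends) (proj₁ (respond (δ θ h) (legal θ h m play)) ends)
  ... | no ¬ends = prover-moves (proj₂ (respond (δ θ h) (legal θ h m play)) ¬ends)
    where
    prover-moves : PWinP F b (δ θ h) m → a ≤ b
    prover-moves (pwinP θ′ move (inj₁ (ends′ , bound))) =
      ≤-trans (prover-ends θ h m θ′ play ¬ends move ends′) bound
    prover-moves (pwinP θ′ move (inj₂ (¬ends′ , respond′))) =
      play-against (step play ¬ends move ¬ends′) respond′

achieves≤guarantees : ∀ {n} {F : ClauseSet n} {a b} → DelayerAchieves F a → ProverGuarantees F b → a ≤ b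
achieves≤guarantees {F = F} (δ , at-start , legal , delayer-ends , prover-ends) guarantees with ends? F ε
... | yes ends = ≤-trans (at-start ends) z≤n
... | no ¬ends = Playoff.play-against δ legal delayer-ends prover-ends (start ¬ends) (guarantees ¬ends)

-- Saturation over a finite type

IsEnumeration : {A : Set} → List A → Set
IsEnumeration xs = ∀ x → x ∈ xs

module _ {A : Set} {xs : List A} (enum : IsEnumeration xs) where

  ∃-enumerated? : {P : A → Set} → (∀ x → Dec (P x)) → Dec (∃ P)
  ∃-enumerated? P? = map′ satisfied (λ (x , p) → lose (enum x) p) (any? P? xs)

vectors : {A : Set} → List A → ∀ n → List (Vec A n)
vectors xs zero = [] ∷ []
vectors xs (suc n) = cartesianProductWith _∷_ xs (vectors xs n)

vectors-enumeration : ∀ {A : Set} {xs : List A} {n} → IsEnumeration xs → IsEnumeration (vectors xs n)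
vectors-enumeration enum [] = here refl
vectors-enumeration enum (x ∷ v) = ∈-cartesianProductWith⁺ _∷_ (enum x) (vectors-enumeration enum v)

module _ {A : Set} where

  count : (A → Bool) → List A → ℕ
  count D [] = 0
  count D (x ∷ xs) = if D x then suc (count D xs) else count D xs

  count≤length : ∀ D xs → count D xs ≤ length xs
  count≤length D [] = z≤n
  count≤length D (x ∷ xs) with D x
  ... | true = s≤s (count≤length D xs)
  ... | false = m≤n⇒m≤1+n (count≤length D xs)

  count-mono : ∀ {D D′} → T ∘ D ⊆ T ∘ D′ → ∀ xs → count D xs ≤ count D′ xs
  count-mono sub [] = z≤n
  count-mono {D} {D′} sub (x ∷ xs) with D x in e | D′ x in e′
  ... | true | true = s≤s (count-mono sub xs)
  ... | false | true = m≤n⇒m≤1+n (count-mono sub xs)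
  ... | false | false = count-mono sub xs
  ... | true | false with () ← subst T e′ (sub (subst T (sym e) _))

  count-mono-< : ∀ {D D′} → T ∘ D ⊆ T ∘ D′ → ∀ {xs} → Any (λ x → T (D′ x) × ¬ T (D x)) xs →
                 count D xs < count D′ xs
  count-mono-< {D} {D′} sub {x ∷ xs} (here (new , old)) with D x in e | D′ x in e′
  ... | true | _ = ⊥-elim (old _)
  ... | false | true = s≤s (count-mono sub xs)
  ... | false | false with () ← new
  count-mono-< {D} {D′} sub {x ∷ xs} (there new) with D x in e | D′ x in e′
  ... | true | true = s≤s (count-mono-< sub new)
  ... | false | true = m≤n⇒m≤1+n (count-mono-< sub new)
  ... | false | false = count-mono-< sub new
  ... | true | false with () ← subst T e′ (sub (subst T (sym e) _))

module _ {A : Set} {xs : List A} (enum : IsEnumeration xs)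
         (step : (A → Bool) → A → Bool) (inflationary : ∀ D → T ∘ D ⊆ T ∘ step D)
         (P : (A → Bool) → Set) (step-preserves : ∀ {D} → P D → P (step D)) where

  PostfixedAbove : (A → Bool) → Set
  PostfixedAbove D = Σ[ D′ ∈ (A → Bool) ] (P D′ × T ∘ D ⊆ T ∘ D′ × T ∘ step D′ ⊆ T ∘ D′)

  private
    postfixed-above′ : ∀ fuel D → P D → length xs ≤ count D xs + fuel → PostfixedAbove D
    postfixed-above′ fuel D pD bound with ∃-enumerated? enum (λ x → T? (step D x) ×-dec ¬? (T? (D x)))
    ... | no closed = D , pD , id , λ {x} s → decidable-stable (T? (D x)) (λ old → closed (x , s , old))
    ... | yes (x , new , old) with count-mono-< (inflationary D) (lose (enum x) (new , old)) | fuel | bound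
    ...   | grows | zero | bound′ = ⊥-elim (<⇒≱ grows (≤-trans (count≤length (step D) xs)
                                                                (subst (length xs ≤_) (+-identityʳ _) bound′)))
    ...   | grows | suc fuel′ | bound′ with postfixed-above′ fuel′ (step D) (step-preserves pD)
                                 (≤-trans (subst (length xs ≤_) (+-suc _ fuel′) bound′) (+-monoˡ-≤ fuel′ grows))
    ...     | D′ , pD′ , above , closed = D′ , pD′ , above ∘ inflationary D , closed

  postfixed-above : ∀ D → P D → PostfixedAbove D
  postfixed-above D pD = postfixed-above′ (length xs) D pD (m≤n+m _ _)

-- Closure under resolutions of small width

booleans : List Bool
booleans = true ∷ false ∷ []

booleans-enumeration : IsEnumeration booleans
booleans-enumeration true = here refl
booleans-enumeration false = there (here refl)

literals : List (Maybe Bool)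
literals = nothing ∷ just true ∷ just false ∷ []

literals-enumeration : IsEnumeration literals
literals-enumeration nothing = here refl
literals-enumeration (just true) = there (here refl)
literals-enumeration (just false) = there (there (here refl))

clauses-enumeration : ∀ {n} → IsEnumeration (vectors literals n)
clauses-enumeration = vectors-enumeration literals-enumeration

clash? : ∀ {n} (C D : Clause n) w → Dec (Clash C D w)
clash? C D w = ∃-enumerated? booleans-enumeration λ b →
  lookup C w ≟ₗ just b ×-dec lookup D w ≟ₗ just (not b)

resolvent? : ∀ {n} (C D R : Clause n) → Dec (Resolvent C D R)
resolvent? C D R = Finₚ.any? λ v →
      clash? C D v
  ×-dec Finₚ.all? (λ w → ¬? (w Finₚ.≟ v) →-dec ¬? (clash? C D w))
  ×-dec lookup R v ≟ₗ nothing
  ×-dec Finₚ.all? (λ w → ¬? (w Finₚ.≟ v) →-dec lookup R w ≟ₗ unionLit (lookup C w) (lookup D w))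

Derivable : ∀ {n} → ClauseSet n → ℕ → Clause n → Set
Derivable F j C = ∃ λ T → ValidTree F T × label T ≡ C × whdT T ≤ j

record SmallResolutionClosure {n} (F : ClauseSet n) (j : ℕ) : Set where
  field
    member    : Clause n → Bool
    derivable : ∀ {C} → T (member C) → Derivable F j C
    axioms    : ∀ {C} → C ∈ F → T (member C)
    closed    : ∀ {C₁ C₂ R} → T (member C₁) → T (member C₂) → size C₁ ⊓ size C₂ ≤ j →
                Resolvent C₁ C₂ R → T (member R)

module _ {n} (F : ClauseSet n) (j : ℕ) where

  private
    SmallResolvent : (Clause n → Bool) → Clause n → Set
    SmallResolvent D R = ∃ λ C₁ → ∃ λ C₂ →
      T (D C₁) × T (D C₂) × size C₁ ⊓ size C₂ ≤ j × Resolvent C₁ C₂ R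

    smallResolvent? : ∀ D R → Dec (SmallResolvent D R)
    smallResolvent? D R = ∃-enumerated? clauses-enumeration λ C₁ → ∃-enumerated? clauses-enumeration λ C₂ →
      T? (D C₁) ×-dec T? (D C₂) ×-dec size C₁ ⊓ size C₂ ≤? j ×-dec resolvent? C₁ C₂ R

    resolution-step : (Clause n → Bool) → Clause n → Bool
    resolution-step D R = D R ∨ isYes (smallResolvent? D R)

    AllDerivable : (Clause n → Bool) → Set
    AllDerivable D = ∀ {C} → T (D C) → Derivable F j C

    resolution-step-derivable : ∀ {D} → AllDerivable D → AllDerivable (resolution-step D)
    resolution-step-derivable {D} derivable {R} t with Equivalence.to Boolₚ.T-∨ t
    ... | inj₁ old = derivable old
    ... | inj₂ new with toWitness new
    ...   | C₁ , C₂ , d₁ , d₂ , small , resolvent with derivable d₁ | derivable d₂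
    ...   | T₁ , V₁ , refl , w₁ | T₂ , V₂ , refl , w₂ =
            node R T₁ T₂ , nodeV resolvent V₁ V₂ , refl , ⊔-lub (⊔-lub w₁ w₂) small

    open import Data.List.Membership.DecPropositional (_≟ᶜ_ {n}) using (_∈?_)

    axioms : Clause n → Bool
    axioms C = isYes (C ∈? F)

    axioms-derivable : AllDerivable axioms
    axioms-derivable {C} t = leaf C , leafV (toWitness {a? = C ∈? F} t) , refl , z≤n

  closure : SmallResolutionClosure F j
  closure with postfixed-above clauses-enumeration resolution-step (λ _ t → Equivalence.from Boolₚ.T-∨ (inj₁ t))
                 AllDerivable resolution-step-derivable axioms axioms-derivable
  ... | D , derivable , above , closed = record
    { member = D
    ; derivable = derivable
    ; axioms = λ {C} C∈F → above (fromWitness {a? = C ∈? F} C∈F)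
    ; closed = λ {C₁} {C₂} {R} d₁ d₂ small resolvent → closed (Equivalence.from Boolₚ.T-∨ (inj₂
                 (fromWitness {a? = smallResolvent? D R} (C₁ , C₂ , d₁ , d₂ , small , resolvent))))
    }

-- The Delayer strategy

idle-achieves-0 : ∀ {n} (F : ClauseSet n) → DelayerAchieves F 0
idle-achieves-0 F =
  (λ θ _ → θ) , (λ _ → z≤n) , (λ _ _ _ play → (λ _ _ → id) , vars play) , (λ _ _ _ _ _ → z≤n) , λ _ _ _ _ _ _ _ _ → z≤n
  where
  vars : ∀ {θ h m} → DPlay F (λ θ _ → θ) θ h m → VarsIn F θ
  vars (start _) v b e = contradiction e (lookup-replicate-nothing v)
  vars (step _ _ (_ , _ , vars′) _) = vars′

module DelayerStrategy {n} {F : ClauseSet n} {j : ℕ} (cl : SmallResolutionClosure F j)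
                       (no-small-refutation : ∀ T → Refutation F T → j < whdT T) where

  open SmallResolutionClosure cl

  Refuted : Assign n → Set
  Refuted θ = ∃ λ C → T (member C) × Falsifies θ C

  refuted? : ∀ θ → Dec (Refuted θ)
  refuted? θ = ∃-enumerated? clauses-enumeration λ C → T? (member C) ×-dec falsifies? θ C

  Forcing : Assign n → Fin n → Bool → Set
  Forcing θ x b = lookup θ x ≡ nothing × ∃ λ C → T (member C) × size C ≤ j × Falsifies (θ [ x ]≔ just b) C

  HasForced : Assign n → Set
  HasForced θ = ∃ λ x → ∃ λ b → Forcing θ x b

  hasForced? : ∀ θ → Dec (HasForced θ)
  hasForced? θ = Finₚ.any? λ x → ∃-enumerated? booleans-enumeration λ b →
    lookup θ x ≟ₗ nothing ×-dec ∃-enumerated? clauses-enumeration λ C →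
      T? (member C) ×-dec size C ≤? j ×-dec falsifies? (θ [ x ]≔ just b) C

  member-VarF : ∀ {C v b} → T (member C) → lookup C v ≡ just b → VarF F v
  member-VarF d e with derivable d
  ... | _ , V , refl , _ = label-VarF V _ _ e

  ε-safe : ¬ Refuted ε
  ε-safe (C , d , f) with derivable d | ε-falsifies⇒emptyClause C f
  ... | T′ , V , label≡C , w≤j | refl = <⇒≱ (no-small-refutation T′ (V , label≡C)) w≤j

  Ends⇒Refuted : ∀ {θ} → Ends F θ → Refuted θ
  Ends⇒Refuted {θ} ends with Ends⇒falsified F {θ} ends
  ... | C , C∈F , f = C , axioms C∈F , f

  forced-literal : ∀ {θ x b C} → ¬ Refuted θ → T (member C) → Falsifies (θ [ x ]≔ just b) C →
                   lookup C x ≡ just (not b)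
  forced-literal {θ} {x} {b} {C} safe d f with falsifies-update {θ = θ} {x} {C} f
  ... | inj₁ f′ = contradiction (C , d , f′) safe
  ... | inj₂ Cx = Cx

  forcing-safe : ∀ {θ x b} → ¬ Refuted θ → Forcing θ x b → ¬ Refuted (θ [ x ]≔ just (not b))
  forcing-safe {θ} {x} {b} safe (θx , C₁ , d₁ , small , f₁) (C₂ , d₂ , f₂) =
    safe ( resolveOn x C₁ C₂ , closed d₁ d₂ (≤-trans (m⊓n≤m _ _) small) resolvent
         , resolveOn-falsified {θ = θ} {x} {C₁} {C₂} off₁ off₂)
    where
    off₁ : FalsifiesExcept x θ C₁
    off₁ = falsifies-update⇒except {θ = θ} {x} {C₁} f₁
    off₂ : FalsifiesExcept x θ C₂
    off₂ = falsifies-update⇒except {θ = θ} {x} {C₂} f₂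
    resolvent : Resolvent C₁ C₂ (resolveOn x C₁ C₂)
    resolvent = resolveOn-resolvent {θ = θ} {x} {C₁} {C₂} off₁ off₂ (forced-literal {θ} {x} {b} safe d₁ f₁)
                  (forced-literal {θ} {x} {not b} safe d₂ f₂)

  record SafeSaturation (θ : Assign n) : Set where
    field
      saturated  : Assign n
      extends    : θ ⊑ saturated
      keeps-vars : VarsIn F θ → VarsIn F saturated
      safe       : ¬ Refuted saturated
      unforced   : ¬ HasForced saturated

  private
    saturate′ : ∀ fuel θ → unassigned θ < fuel → ¬ Refuted θ → SafeSaturation θ
    saturate′ (suc fuel) θ bound safe-θ with hasForced? θ
    ... | no unforced = record { saturated = θ ; extends = λ _ _ → id ; keeps-vars = id
                               ; safe = safe-θ ; unforced = unforced }
    ... | yes (x , b , forcing@(θx , C , d , _ , f)) = record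
      { saturated = saturated
      ; extends = ⊑-trans {θ₁ = θ} {θ [ x ]≔ just (not b)} {saturated} (⊑-update θ x _ θx) extends
      ; keeps-vars = λ vars → keeps-vars (VarsIn-update θ x (not b) vars
                                            (member-VarF d (forced-literal {θ} {x} {b} safe-θ d f)))
      ; safe = safe
      ; unforced = unforced
      }
      where
      open SafeSaturation (saturate′ fuel (θ [ x ]≔ just (not b))
                             (subst (_≤ fuel) (unassigned-update θ x (not b) θx) (≤-pred bound))
                             (forcing-safe {θ} {x} {b} safe-θ forcing))

  saturate : ∀ θ → ¬ Refuted θ → SafeSaturation θ
  saturate θ = saturate′ (suc (unassigned θ)) θ ≤-refl

  -- Once a derivable clause is falsified there is nothing left to protect, and Delayer passes.
  respond : ∀ θ → Dec (Refuted θ) → Assign n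
  respond θ (yes _) = θ
  respond θ (no safe) = SafeSaturation.saturated (saturate θ safe)

  δ : DStrategy n
  δ θ _ = respond θ (refuted? θ)

  δ-legal : ∀ θ h → VarsIn F θ → DMove F θ (δ θ h)
  δ-legal θ _ vars with refuted? θ
  ... | yes _ = (λ _ _ → id) , vars
  ... | no safe = extends , keeps-vars vars
    where open SafeSaturation (saturate θ safe)

  δ-safe : ∀ θ h → ¬ Refuted θ → ¬ Refuted (δ θ h) × ¬ HasForced (δ θ h)
  δ-safe θ _ safe-θ with refuted? θ
  ... | yes refuted = contradiction refuted safe-θ
  ... | no safe-θ′ = safe , unforced
    where open SafeSaturation (saturate θ safe-θ′)

  small-move-safe : ∀ {θ θ′} → ¬ HasForced θ → PMove F θ θ′ → size θ′ ≤ j → ¬ Refuted θ′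
  small-move-safe {θ} {θ′} unforced move small (C , d , f) with PMove⇒⊑-update {F = F} {θ} {θ′} move
  ... | x , θx , b , sub = unforced (x , b , θx , C , d , ≤-trans (falsifies⇒size≤ {θ = θ′} {C} f) small
                                     , falsifies-⊑ {θ = θ′} {θ [ x ]≔ just b} {C} sub f)

  mutual
    play-invariant : ∀ {θ h m} → DPlay F δ θ h m → VarsIn F θ × (m ≤ j → ¬ Refuted θ)
    play-invariant (start _) = (λ v _ e → contradiction e (lookup-replicate-nothing v)) , λ _ → ε-safe
    play-invariant (step {θ′ = θ′} play _ move _) =
      proj₂ (proj₂ move) , small-prover-move-safe {θ′ = θ′} play move

    small-prover-move-safe : ∀ {θ h m θ′} → DPlay F δ θ h m → PMove F (δ θ h) θ′ →
                             m ⊔ size θ′ ≤ j → ¬ Refuted θ′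
    small-prover-move-safe {θ} {h} {m} {θ′} play move m⊔size≤j =
      small-move-safe {δ θ h} {θ′} (proj₂ (δ-safe θ h (proj₂ (play-invariant play) (m⊔n≤o⇒m≤o m _ m⊔size≤j))))
                      move (m⊔n≤o⇒n≤o m _ m⊔size≤j)

  delayer-achieves : DelayerAchieves F (suc j)
  delayer-achieves = δ , (λ ends → contradiction (Ends⇒Refuted {ε} ends) ε-safe) , legal , delayer-ends , prover-ends
    where
    legal : ∀ θ h m → DPlay F δ θ h m → DMove F θ (δ θ h)
    legal θ h _ play = δ-legal θ h (proj₁ (play-invariant play))
    delayer-ends : ∀ θ h m → DPlay F δ θ h m → Ends F (δ θ h) → suc j ≤ m
    delayer-ends θ h _ play ends = ≰⇒> λ m≤j →
      proj₁ (δ-safe θ h (proj₂ (play-invariant play) m≤j)) (Ends⇒Refuted {δ θ h} ends)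
    prover-ends : ∀ θ h m θ′ → DPlay F δ θ h m → ¬ Ends F (δ θ h) →
                  PMove F (δ θ h) θ′ → Ends F θ′ → suc j ≤ m ⊔ size θ′
    prover-ends _ _ _ θ′ play _ move ends = ≰⇒> λ m⊔size≤j →
      small-prover-move-safe {θ′ = θ′} play move m⊔size≤j (Ends⇒Refuted {θ′} ends)

delayer-achieves-whd : ∀ {n} (F : ClauseSet n) {w} → IsWhd F w → DelayerAchieves F w
delayer-achieves-whd F {zero} _ = idle-achieves-0 F
delayer-achieves-whd F {suc j} (_ , minimal) = DelayerStrategy.delayer-achieves (closure F j) minimal

theorem5p12 : ∀ {n} (F : ClauseSet n) → Unsatisfiable F →
    (∀ k → DelayerAchieves F k → ∀ w → IsWhd F w → k ≤ w)
  × (∀ k → ProverGuarantees F k → ∀ w → IsWhd F w → w ≤ k)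
  × (∀ w → IsWhd F w → DelayerAchieves F w)
  × (∀ w → IsWhd F w → ProverGuarantees F w)
theorem5p12 F _ =
    (λ k achieves w whd → achieves≤guarantees achieves (prover-guarantees-whd F whd))
  , (λ k guarantees w whd → achieves≤guarantees (delayer-achieves-whd F whd) guarantees)
  , (λ w → delayer-achieves-whd F)
  , (λ w → prover-guarantees-whd F)
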